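{- Let $P(X)=\sum_{i=0}^{m} A_iX^i$ be a polynomial over FDDSs. If no non-constant coefficient $A_i$ ($i\ge 1$) of $P$ contains a dendron, then $P$ is not injective, i.e. there exist FDDSs $X\ne Y$ with $P(X)=P(Y)$.
   Context: An FDDS is a finite set with a total function on it, viewed as a functional digraph up to isomorphism. Sum is disjoint union and product is the direct product of digraphs (vertex set $V(A)\times V(B)$, arc $(u,u')\to(v,v')$ iff $u\to v$ and $u'\to v'$); $X^0$ is the single fixed point. A dendron is a connected FDDS whose unique cycle has length $1$; "$A$ contains a dendron" means some connected component of $A$ is a dendron. -}

module Defs where

open import Data.Nat using (ℕ; zero; suc; _+_; _*_; _≤_)
open import Data.Fin using (Fin; splitAt; join; remQuot; combine)
open import Data.Sum using (_⊎_) renaming (map to ⊎-map)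
open import Data.Product using (Σ; ∃; _×_; _,_; proj₁; proj₂)
open import Function using (_↔_; Inverse; id)
open import Relation.Binary.PropositionalEquality using (_≡_)
open import Relation.Nullary using (¬_)

record FDDS : Set where
  constructor mkFDDS
  field
    size : ℕ
    fun  : Fin size → Fin size
open FDDS public

_≅_ : FDDS → FDDS → Set
A ≅ B = Σ (Fin (size A) ↔ Fin (size B)) λ φ →
          ∀ x → Inverse.to φ (fun A x) ≡ fun B (Inverse.to φ x)

_⊕_ : FDDS → FDDS → FDDS
A ⊕ B = mkFDDS (size A + size B)
  (λ x → join (size A) (size B) (⊎-map (fun A) (fun B) (splitAt (size A) x)))

_⊗_ : FDDS → FDDS → FDDS
A ⊗ B = mkFDDS (size A * size B)
  (λ x → let p = remQuot {size A} (size B) x in combine (fun A (proj₁ p)) (fun B (proj₂ p)))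

𝟘 : FDDS
𝟘 = mkFDDS 0 (λ x → x)

𝟙 : FDDS
𝟙 = mkFDDS 1 id

_^_ : FDDS → ℕ → FDDS
X ^ zero    = 𝟙
X ^ suc k   = X ⊗ (X ^ k)

sumFrom : (ℕ → FDDS) → FDDS → ℕ → ℕ → FDDS
sumFrom A X k zero    = 𝟘
sumFrom A X k (suc n) = (A k ⊗ (X ^ k)) ⊕ sumFrom A X (suc k) n

-- Evaluation of P(X) = Σ_{i=0}^{m} A_i X^i, A given by its coefficients A 0 … A m
-- (values of A beyond m are irrelevant).
evalPoly : ℕ → (ℕ → FDDS) → FDDS → FDDS
evalPoly m A X = sumFrom A X 0 (suc m)

data Conn (A : FDDS) : Fin (size A) → Fin (size A) → Set where
  arc    : ∀ x → Conn A x (fun A x)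
  rfl    : ∀ x → Conn A x x
  sym′   : ∀ {x y} → Conn A x y → Conn A y x
  trans′ : ∀ {x y z} → Conn A x y → Conn A y z → Conn A x z

-- The connected component of x is a dendron: its unique cycle has length 1,
-- i.e. the cycle of the component is a loop (a fixed point y in the component).
DendronComponent : (A : FDDS) → Fin (size A) → Set
DendronComponent A x = ∃ λ y → Conn A x y × fun A y ≡ y

ContainsDendron : FDDS → Set
ContainsDendron A = ∃ λ x → DendronComponent A x

-- A component whose cycle has length ℓ ≥ 2 cannot tell the FDDS ℓ (ℓ fixed points) from the
-- cycle C_ℓ: over C_ℓ the rotations x ↦ x + c form an isomorphism C_ℓ ⊗ ℓ ≅ C_ℓ ⊗ C_ℓ.
-- Splitting the expansion of ∏_{k=2}^{N+2} (k + C_k) into the terms with an even and with an odd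
-- number of cycle factors gives X and Y; X has a fixed point and Y has none, yet X ≅ Y over
-- C_2 ⊕ ⋯ ⊕ C_{N+2}. Containing no dendron means having no fixed point, and such an FDDS with at
-- most N + 2 states maps into C_2 ⊕ ⋯ ⊕ C_{N+2}, each state going to its phase on the cycle it
-- falls into. Pulling back along these maps gives A_i ⊗ X^i ≅ A_i ⊗ Y^i for i ≥ 1, so P(X) ≅ P(Y).

module Submission where

open import Defs
open import Data.Nat using (ℕ; zero; suc; _+_; _*_; _∸_; _⊔_; _≤_; _<_; s≤s; z≤n; z<s; NonZero)
open import Data.Nat.Properties
  using ( +-comm; +-assoc; +-suc; <⇒≤; ≤-pred; ≤-trans; ≤-antisym; ≮⇒≥; n<1+n; <-cmp; +-monoʳ-<; ≤∧≢⇒<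
        ; m∸n+n≡m; m+[n∸m]≡n; m≤n⇒∃[o]m+o≡n; m<n⇒0<n∸m; 1+n≢n; 0≢1+n; m≤n⇒m<n∨m≡n; ≤-refl; m<m+n; m≤n+m; m≤m⊔n; m≤n⇒m≤o⊔n; module ≤-Reasoning)
  renaming (_≟_ to _≟ℕ_)
open import Data.Nat.DivMod
  using (_%_; _/_; _mod_; %-distribˡ-+; m%n%n≡m%n; [m+n]%n≡m%n; m<n⇒m%n≡m; n%n≡0; m%n<n; m%n≤n; m≡m%n+[m/n]*n)
open import Data.Nat.GeneralisedArithmetic using (fold; fold-+)
open import Data.Fin using (Fin; zero; suc; toℕ; splitAt; join; remQuot; combine)
open import Data.Fin.Properties
  using ( splitAt-join; +↔⊎; remQuot-combine; combine-remQuot; toℕ-fromℕ<; toℕ-injective; toℕ<n; toℕ≤pred[n]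
        ; pigeonhole; injective⇒≤; any?)
  renaming (_≟_ to _≟ᶠ_)
open import Data.Sum using (_⊎_; inj₁; inj₂; swap; [_,_]′) renaming (map to ⊎-map)
open import Data.Sum.Properties using (map-map; map-cong; swap-↔; inj₁-injective; inj₂-injective)
open import Data.Sum.Function.Propositional using (_⊎-↔_)
open import Data.Product using (Σ; ∃; _×_; _,_; proj₁; proj₂; uncurry)
open import Data.Product.Properties using (,-injective)
open import Data.Product.Function.NonDependent.Propositional using (_×-↔_)
open import Function using (_∘_; _↔_; Inverse; mk↔ₛ′; id)
open import Function.Properties.Inverse using (↔-refl; ↔-sym; ↔-trans)
open import Relation.Binary.PropositionalEquality
open import Relation.Nullary using (¬_; yes; no)
open import Relation.Nullary.Decidable using (map′)
open import Relation.Unary using (Decidable)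
open import Data.Empty using (⊥; ⊥-elim)
open import Relation.Binary.Definitions using (tri<; tri≈; tri>)

open Inverse using (to; from; strictlyInverseˡ; strictlyInverseʳ)

private variable
  m m′ n n′ : ℕ

-- By definition, fun (A ⊕ B) is fun A ⊕ᶠ fun B and fun (A ⊗ B) is fun A ⊗ᶠ λ _ → fun B.
_⊕ᶠ_ : (Fin m → Fin m′) → (Fin n → Fin n′) → Fin (m + n) → Fin (m′ + n′)
_⊕ᶠ_ {m} {m′} {n} {n′} f g = join m′ n′ ∘ ⊎-map f g ∘ splitAt m

⊕ᶠ-join : (f : Fin m → Fin m′) (g : Fin n → Fin n′) (s : Fin m ⊎ Fin n) →
          (f ⊕ᶠ g) (join m n s) ≡ join m′ n′ (⊎-map f g s)
⊕ᶠ-join {m} {m′} {n} {n′} f g s = cong (join m′ n′ ∘ ⊎-map f g) (splitAt-join m n s)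

⊕ᶠ-commute : {P P′ Q Q′ : FDDS}
             (f f₊ : Fin (size P) → Fin (size Q)) (g g₊ : Fin (size P′) → Fin (size Q′)) →
             f₊ ∘ fun P ≗ fun Q ∘ f → g₊ ∘ fun P′ ≗ fun Q′ ∘ g →
             (f₊ ⊕ᶠ g₊) ∘ fun (P ⊕ P′) ≗ fun (Q ⊕ Q′) ∘ (f ⊕ᶠ g)
⊕ᶠ-commute {P} {P′} {Q} {Q′} f f₊ g g₊ f-comm g-comm z = begin
  (f₊ ⊕ᶠ g₊) (fun (P ⊕ P′) z)                      ≡⟨ ⊕ᶠ-join f₊ g₊ (⊎-map (fun P) (fun P′) s) ⟩
  join _ _ (⊎-map f₊ g₊ (⊎-map (fun P) (fun P′) s)) ≡⟨ cong (join _ _) (map-map s) ⟩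
  join _ _ (⊎-map (f₊ ∘ fun P) (g₊ ∘ fun P′) s)     ≡⟨ cong (join _ _) (map-cong f-comm g-comm s) ⟩
  join _ _ (⊎-map (fun Q ∘ f) (fun Q′ ∘ g) s)       ≡⟨ cong (join _ _) (map-map s) ⟨
  join _ _ (⊎-map (fun Q) (fun Q′) (⊎-map f g s))   ≡⟨ ⊕ᶠ-join (fun Q) (fun Q′) (⊎-map f g s) ⟨
  fun (Q ⊕ Q′) ((f ⊕ᶠ g) z)                        ∎
  where
  open ≡-Reasoning
  s = splitAt (size P) z

_⊗ᶠ_ : (Fin m → Fin m′) → (Fin m → Fin n → Fin n′) → Fin (m * n) → Fin (m′ * n′)
_⊗ᶠ_ {m} {n = n} f g z = let (a , x) = remQuot {m} n z in combine (f a) (g a x)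

⊗ᶠ-combine : (f : Fin m → Fin m′) (g : Fin m → Fin n → Fin n′) (a : Fin m) (x : Fin n) →
             (f ⊗ᶠ g) (combine a x) ≡ combine (f a) (g a x)
⊗ᶠ-combine f g a x = cong (λ (a , x) → combine (f a) (g a x)) (remQuot-combine a x)

⊗ᶠ-commute : {P P′ Q Q′ : FDDS}
             (f f₊ : Fin (size P) → Fin (size Q)) (g g₊ : Fin (size P) → Fin (size P′) → Fin (size Q′)) →
             f₊ ∘ fun P ≗ fun Q ∘ f → (∀ a x → g₊ (fun P a) (fun P′ x) ≡ fun Q′ (g a x)) →
             (f₊ ⊗ᶠ g₊) ∘ fun (P ⊗ P′) ≗ fun (Q ⊗ Q′) ∘ (f ⊗ᶠ g)
⊗ᶠ-commute {P} {P′} {Q} {Q′} f f₊ g g₊ f-comm g-comm z = begin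
  (f₊ ⊗ᶠ g₊) (fun (P ⊗ P′) z)                   ≡⟨ ⊗ᶠ-combine f₊ g₊ (fun P a) (fun P′ x) ⟩
  combine (f₊ (fun P a)) (g₊ (fun P a) (fun P′ x)) ≡⟨ cong₂ combine (f-comm a) (g-comm a x) ⟩
  combine (fun Q (f a)) (fun Q′ (g a x))         ≡⟨ ⊗ᶠ-combine (fun Q) (λ _ → fun Q′) (f a) (g a x) ⟨
  fun (Q ⊗ Q′) ((f ⊗ᶠ g) z)                     ∎
  where
  open ≡-Reasoning
  a = proj₁ (remQuot {size P} (size P′) z)
  x = proj₂ (remQuot {size P} (size P′) z)

*↔× : Fin (m * n) ↔ (Fin m × Fin n)
*↔× {m} {n} = mk↔ₛ′ (remQuot n) (uncurry combine) (uncurry remQuot-combine) (combine-remQuot {m} n)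

_⊕-↔_ : Fin m ↔ Fin m′ → Fin n ↔ Fin n′ → Fin (m + n) ↔ Fin (m′ + n′)
φ ⊕-↔ ψ = ↔-trans +↔⊎ (↔-trans (φ ⊎-↔ ψ) (↔-sym +↔⊎))

_⊗-↔_ : Fin m ↔ Fin m′ → Fin n ↔ Fin n′ → Fin (m * n) ↔ Fin (m′ * n′)
φ ⊗-↔ ψ = ↔-trans *↔× (↔-trans (φ ×-↔ ψ) (↔-sym *↔×))

swap-+↔ : Fin (m + n) ↔ Fin (n + m)
swap-+↔ {m} {n} = ↔-trans (+↔⊎ {m} {n}) (↔-trans swap-↔ (↔-sym +↔⊎))

fibrewise-↔ : (Fin m → Fin n ↔ Fin n′) → Fin (m * n) ↔ Fin (m * n′)
fibrewise-↔ σ = ↔-trans *↔× (↔-trans Σσ (↔-sym *↔×))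
  where
  Σσ = mk↔ₛ′ (λ (a , x) → a , to (σ a) x) (λ (a , y) → a , from (σ a) y)
             (λ (a , y) → cong (a ,_) (strictlyInverseˡ (σ a) y))
             (λ (a , x) → cong (a ,_) (strictlyInverseʳ (σ a) x))

swap-+↔-commute : (f : Fin m → Fin m′) (g : Fin n → Fin n′) →
                to (swap-+↔ {m′} {n′}) ∘ (f ⊕ᶠ g) ≗ (g ⊕ᶠ f) ∘ to (swap-+↔ {m} {n})
swap-+↔-commute {m} {m′} {n} {n′} f g z = begin
  join n′ m′ (swap (splitAt m′ (join m′ n′ (⊎-map f g s))))  ≡⟨ cong (join n′ m′ ∘ swap) (splitAt-join m′ n′ (⊎-map f g s)) ⟩
  join n′ m′ (swap (⊎-map f g s))                            ≡⟨ cong (join n′ m′) (swap-map s) ⟩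
  join n′ m′ (⊎-map g f (swap s))                            ≡⟨ ⊕ᶠ-join g f (swap s) ⟨
  (g ⊕ᶠ f) (join n m (swap s))                               ∎
  where
  open ≡-Reasoning
  s = splitAt m z
  swap-map : (s : Fin m ⊎ Fin n) → swap (⊎-map f g s) ≡ ⊎-map g f (swap s)
  swap-map (inj₁ _) = refl
  swap-map (inj₂ _) = refl

-- Isomorphisms over a base

-- An isomorphism B ⊗ P ≅ B ⊗ Q over B, of the form (b , x) ↦ (b , fibre b x).
record FibreIso (B P Q : FDDS) : Set where
  field
    fibre   : Fin (size B) → Fin (size P) ↔ Fin (size Q)
    commute : ∀ b → to (fibre (fun B b)) ∘ fun P ≗ fun Q ∘ to (fibre b)

  at : Fin (size B) → Fin (size P) → Fin (size Q)
  at b = to (fibre b)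

open FibreIso

Hom : FDDS → FDDS → Set
Hom A B = Σ (Fin (size A) → Fin (size B)) λ h → h ∘ fun A ≗ fun B ∘ h

fibre-refl : {B P : FDDS} → FibreIso B P P
fibre-refl = record { fibre = λ _ → ↔-refl ; commute = λ _ _ → refl }

fibre-sym : {B P Q : FDDS} → FibreIso B P Q → FibreIso B Q P
fibre-sym {B} {P} {Q} σ = record { fibre = ↔-sym ∘ fibre σ ; commute = commute′ }
  where
  commute′ : ∀ b → from (fibre σ (fun B b)) ∘ fun Q ≗ fun P ∘ from (fibre σ b)
  commute′ b y = begin
    from σ₊ (fun Q y)                                      ≡⟨ cong (from σ₊ ∘ fun Q) (strictlyInverseˡ (fibre σ b) y) ⟨
    from σ₊ (fun Q (to (fibre σ b) (from (fibre σ b) y))) ≡⟨ cong (from σ₊) (commute σ b _) ⟨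
    from σ₊ (to σ₊ (fun P (from (fibre σ b) y)))           ≡⟨ strictlyInverseʳ σ₊ _ ⟩
    fun P (from (fibre σ b) y)                             ∎
    where
    open ≡-Reasoning
    σ₊ = fibre σ (fun B b)

fibre-trans : {B P Q R : FDDS} → FibreIso B P Q → FibreIso B Q R → FibreIso B P R
fibre-trans {B} σ τ = record
  { fibre   = λ b → ↔-trans (fibre σ b) (fibre τ b)
  ; commute = λ b x → trans (cong (at τ (fun B b)) (commute σ b x)) (commute τ b _)
  }

fibre-pullback : {A B P Q : FDDS} → Hom A B → FibreIso B P Q → FibreIso A P Q
fibre-pullback {P = P} (h , h-hom) σ = record
  { fibre   = fibre σ ∘ h
  ; commute = λ a x → trans (cong (λ b → at σ b (fun P x)) (h-hom a)) (commute σ (h a) x)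
  }

fibre-⊕-comm : {B P Q : FDDS} → FibreIso B (P ⊕ Q) (Q ⊕ P)
fibre-⊕-comm {P = P} {Q} = record
  { fibre   = λ _ → swap-+↔ {size P} {size Q}
  ; commute = λ _ → swap-+↔-commute (fun P) (fun Q)
  }

module _ {B P Q P′ Q′ : FDDS} where

  fibre-⊕ : FibreIso B P Q → FibreIso B P′ Q′ → FibreIso B (P ⊕ P′) (Q ⊕ Q′)
  fibre-⊕ σ τ = record
    { fibre   = λ b → fibre σ b ⊕-↔ fibre τ b
    ; commute = λ b → ⊕ᶠ-commute (at σ b) (at σ (fun B b)) (at τ b) (at τ (fun B b))
                                  (commute σ b) (commute τ b)
    }

  fibre-⊗ : FibreIso B P Q → FibreIso B P′ Q′ → FibreIso B (P ⊗ P′) (Q ⊗ Q′)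
  fibre-⊗ σ τ = record
    { fibre   = λ b → fibre σ b ⊗-↔ fibre τ b
    ; commute = λ b → ⊗ᶠ-commute {P} {P′} {Q} {Q′} (at σ b) (at σ (fun B b)) (λ _ → at τ b)
                                  (λ _ → at τ (fun B b)) (commute σ b) (λ _ → commute τ b)
    }

fibre-^ : {B P Q : FDDS} → FibreIso B P Q → ∀ i → FibreIso B (P ^ i) (Q ^ i)
fibre-^ σ zero     = fibre-refl
fibre-^ σ (suc i)  = fibre-⊗ σ (fibre-^ σ i)

fibre-over-⊕ : {B B′ P Q : FDDS} → FibreIso B P Q → FibreIso B′ P Q → FibreIso (B ⊕ B′) P Q
fibre-over-⊕ {B} {B′} {P} {Q} σ τ = record { fibre = fibre′ ; commute = commute′ }
  where
  fibre′ : Fin (size B + size B′) → Fin (size P) ↔ Fin (size Q)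
  fibre′ = [ fibre σ , fibre τ ]′ ∘ splitAt (size B)
  on-summands : ∀ s x → to ([ fibre σ , fibre τ ]′ (⊎-map (fun B) (fun B′) s)) (fun P x)
                        ≡ fun Q (to ([ fibre σ , fibre τ ]′ s) x)
  on-summands (inj₁ b) = commute σ b
  on-summands (inj₂ b) = commute τ b
  commute′ : ∀ z → to (fibre′ (fun (B ⊕ B′) z)) ∘ fun P ≗ fun Q ∘ to (fibre′ z)
  commute′ z x = trans (cong (λ s′ → to ([ fibre σ , fibre τ ]′ s′) (fun P x)) (splitAt-join (size B) (size B′) s))
                       (on-summands (splitAt (size B) z) x)
    where s = ⊎-map (fun B) (fun B′) (splitAt (size B) z)

fibre⇒⊗≅ : {B P Q : FDDS} → FibreIso B P Q → (B ⊗ P) ≅ (B ⊗ Q)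
fibre⇒⊗≅ {B} {P} {Q} σ = fibrewise-↔ (fibre σ) , ⊗ᶠ-commute {P′ = P} {Q′ = Q} id id (at σ) (at σ) (λ _ → refl) (commute σ)

≅-refl : {A : FDDS} → A ≅ A
≅-refl = ↔-refl , λ _ → refl

≅-⊕ : {A A′ B B′ : FDDS} → A ≅ A′ → B ≅ B′ → (A ⊕ B) ≅ (A′ ⊕ B′)
≅-⊕ (φ , φ-comm) (ψ , ψ-comm) = φ ⊕-↔ ψ , ⊕ᶠ-commute (to φ) (to φ) (to ψ) (to ψ) φ-comm ψ-comm

-- Cycles and the pair X, Y

[m%d+n]%d≡[m+n]%d : ∀ m n d .{{_ : NonZero d}} → (m % d + n) % d ≡ (m + n) % d
[m%d+n]%d≡[m+n]%d m n d = begin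
  (m % d + n) % d          ≡⟨ %-distribˡ-+ (m % d) n d ⟩
  (m % d % d + n % d) % d  ≡⟨ cong (λ x → (x + n % d) % d) (m%n%n≡m%n m d) ⟩
  (m % d + n % d) % d      ≡⟨ %-distribˡ-+ m n d ⟨
  (m + n) % d              ∎
  where open ≡-Reasoning

[m+n%d]%d≡[m+n]%d : ∀ m n d .{{_ : NonZero d}} → (m + n % d) % d ≡ (m + n) % d
[m+n%d]%d≡[m+n]%d m n d = begin
  (m + n % d) % d  ≡⟨ cong (_% d) (+-comm m (n % d)) ⟩
  (n % d + m) % d  ≡⟨ [m%d+n]%d≡[m+n]%d n m d ⟩
  (n + m) % d      ≡⟨ cong (_% d) (+-comm n m) ⟩
  (m + n) % d      ∎
  where open ≡-Reasoning

module _ {n : ℕ} .{{_ : NonZero n}} where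

  toℕ-mod : ∀ m → toℕ (m mod n) ≡ m % n
  toℕ-mod m = toℕ-fromℕ< _

  mod-cong : ∀ {m m′} → m % n ≡ m′ % n → m mod n ≡ m′ mod n
  mod-cong {m} {m′} eq = toℕ-injective (trans (toℕ-mod m) (trans eq (sym (toℕ-mod m′))))

  toℕ-mod-inverse : (i : Fin n) → toℕ i mod n ≡ i
  toℕ-mod-inverse i = toℕ-injective (trans (toℕ-mod (toℕ i)) (m<n⇒m%n≡m (toℕ<n i)))

  shift : ℕ → Fin n → Fin n
  shift t v = (t + toℕ v) mod n

  shift-mod : ∀ t m → shift t (m mod n) ≡ (t + m) mod n
  shift-mod t m = mod-cong (trans (cong (λ x → (t + x) % n) (toℕ-mod m)) ([m+n%d]%d≡[m+n]%d t m n))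

  shift-shift : ∀ s t v → shift s (shift t v) ≡ shift (s + t) v
  shift-shift s t v = trans (shift-mod s (t + toℕ v)) (cong (_mod n) (sym (+-assoc s t (toℕ v))))

  shift-% : ∀ t v → shift (t % n) v ≡ shift t v
  shift-% t v = mod-cong ([m%d+n]%d≡[m+n]%d t (toℕ v) n)

  shift-n : ∀ v → shift n v ≡ v
  shift-n v = trans (mod-cong (trans (cong (_% n) (+-comm n (toℕ v))) ([m+n]%n≡m%n (toℕ v) n)))
                    (toℕ-mod-inverse v)

Cycle : (n : ℕ) .{{_ : NonZero n}} → FDDS
Cycle n = mkFDDS n (shift 1)

Fixed : ℕ → FDDS
Fixed n = mkFDDS n id

fibre-rotation : (n : ℕ) .{{_ : NonZero n}} → FibreIso (Cycle n) (Fixed n) (Cycle n)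
fibre-rotation n = record { fibre = rotate ; commute = commute′ }
  where
  rotate : Fin n → Fin n ↔ Fin n
  rotate c = mk↔ₛ′ (shift (toℕ c)) (shift (n ∸ toℕ c))
    (λ y → trans (shift-shift (toℕ c) (n ∸ toℕ c) y)
                 (trans (cong (λ t → shift t y) (m+[n∸m]≡n (<⇒≤ (toℕ<n c)))) (shift-n y)))
    (λ v → trans (shift-shift (n ∸ toℕ c) (toℕ c) v)
                 (trans (cong (λ t → shift t v) (m∸n+n≡m (<⇒≤ (toℕ<n c)))) (shift-n v)))
  commute′ : ∀ c v → shift (toℕ (shift 1 c)) v ≡ shift 1 (shift (toℕ c) v)
  commute′ c v = begin
    shift (toℕ (shift 1 c)) v   ≡⟨ cong (λ t → shift t v) (toℕ-mod (1 + toℕ c)) ⟩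
    shift ((1 + toℕ c) % n) v   ≡⟨ shift-% (1 + toℕ c) v ⟩
    shift (1 + toℕ c) v         ≡⟨ shift-shift 1 (toℕ c) v ⟨
    shift 1 (shift (toℕ c) v)   ∎
    where open ≡-Reasoning

Cycles X Y : ℕ → FDDS
Cycles zero    = Cycle 2
Cycles (suc j) = Cycles j ⊕ Cycle (3 + j)
X zero    = Fixed 2
X (suc j) = (X j ⊗ Fixed (3 + j)) ⊕ (Y j ⊗ Cycle (3 + j))
Y zero    = Cycle 2
Y (suc j) = (X j ⊗ Cycle (3 + j)) ⊕ (Y j ⊗ Fixed (3 + j))

fibre-Cycles : ∀ j → FibreIso (Cycles j) (X j) (Y j)
fibre-Cycles zero    = fibre-rotation 2
fibre-Cycles (suc j) = fibre-over-⊕ over-Cycles over-new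
  where
  σ = fibre-Cycles j
  ρ = fibre-rotation (3 + j)
  swapped : FibreIso (Cycles j) (X (suc j)) ((Y j ⊗ Fixed (3 + j)) ⊕ (X j ⊗ Cycle (3 + j)))
  swapped = fibre-⊕ (fibre-⊗ σ (fibre-refl {P = Fixed (3 + j)})) (fibre-⊗ (fibre-sym σ) (fibre-refl {P = Cycle (3 + j)}))
  over-Cycles : FibreIso (Cycles j) (X (suc j)) (Y (suc j))
  over-Cycles = fibre-trans swapped (fibre-⊕-comm {P = Y j ⊗ Fixed (3 + j)} {Q = X j ⊗ Cycle (3 + j)})
  over-new : FibreIso (Cycle (3 + j)) (X (suc j)) (Y (suc j))
  over-new = fibre-⊕ (fibre-⊗ (fibre-refl {P = X j}) ρ) (fibre-⊗ (fibre-refl {P = Y j}) (fibre-sym ρ))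

HasFixedPoint : FDDS → Set
HasFixedPoint A = ∃ λ x → fun A x ≡ x

≅-fixed : {A B : FDDS} → A ≅ B → HasFixedPoint A → HasFixedPoint B
≅-fixed (φ , φ-comm) (x , fx≡x) = to φ x , trans (sym (φ-comm x)) (cong (to φ) fx≡x)

fixed-⊕ˡ : {A B : FDDS} → HasFixedPoint A → HasFixedPoint (A ⊕ B)
fixed-⊕ˡ {A} {B} (a , fa≡a) = join _ _ (inj₁ a) , trans (⊕ᶠ-join (fun A) (fun B) (inj₁ a)) (cong (join _ _ ∘ inj₁) fa≡a)

fixed-⊕⁻ : {A B : FDDS} → HasFixedPoint (A ⊕ B) → HasFixedPoint A ⊎ HasFixedPoint B
fixed-⊕⁻ {A} {B} (z , fz≡z) = on-summands (splitAt (size A) z)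
  (trans (sym (splitAt-join (size A) (size B) _)) (cong (splitAt (size A)) fz≡z))
  where
  on-summands : ∀ s → ⊎-map (fun A) (fun B) s ≡ s → HasFixedPoint A ⊎ HasFixedPoint B
  on-summands (inj₁ a) eq = inj₁ (a , inj₁-injective eq)
  on-summands (inj₂ b) eq = inj₂ (b , inj₂-injective eq)

fixed-⊗ : {A B : FDDS} → HasFixedPoint A → HasFixedPoint B → HasFixedPoint (A ⊗ B)
fixed-⊗ {A} {B} (a , fa≡a) (b , fb≡b) =
  combine a b , trans (⊗ᶠ-combine (fun A) (λ _ → fun B) a b) (cong₂ combine fa≡a fb≡b)

fixed-⊗⁻ : {A B : FDDS} → HasFixedPoint (A ⊗ B) → HasFixedPoint A × HasFixedPoint B
fixed-⊗⁻ {A} {B} (z , fz≡z) = (a , proj₁ eqs) , (b , proj₂ eqs)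
  where
  a = proj₁ (remQuot {size A} (size B) z)
  b = proj₂ (remQuot {size A} (size B) z)
  eqs = ,-injective (trans (sym (remQuot-combine (fun A a) (fun B b))) (cong (remQuot (size B)) fz≡z))

Cycle-no-fixed : ∀ n → ¬ HasFixedPoint (Cycle (2 + n))
Cycle-no-fixed n (x , fx≡x) = [ below-top , at-top ]′ (m≤n⇒m<n∨m≡n (toℕ≤pred[n] x))
  where
  rotated : suc (toℕ x) % (2 + n) ≡ toℕ x
  rotated = trans (sym (toℕ-mod (suc (toℕ x)))) (cong toℕ fx≡x)
  below-top : toℕ x < suc n → ⊥
  below-top x<1+n = 1+n≢n (trans (sym (m<n⇒m%n≡m (s≤s x<1+n))) rotated)
  at-top : toℕ x ≡ suc n → ⊥
  at-top x≡1+n = 0≢1+n (begin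
    0                      ≡⟨ n%n≡0 (2 + n) ⟨
    (2 + n) % (2 + n)      ≡⟨ cong (λ t → suc t % (2 + n)) x≡1+n ⟨
    suc (toℕ x) % (2 + n)  ≡⟨ rotated ⟩
    toℕ x                  ≡⟨ x≡1+n ⟩
    suc n                  ∎)
    where open ≡-Reasoning

X-fixed : ∀ j → HasFixedPoint (X j)
X-fixed zero    = zero , refl
X-fixed (suc j) = fixed-⊕ˡ {B = Y j ⊗ Cycle (3 + j)} (fixed-⊗ {B = Fixed (3 + j)} (X-fixed j) (zero , refl))

Y-no-fixed : ∀ j → ¬ HasFixedPoint (Y j)
Y-no-fixed zero    = Cycle-no-fixed 0
Y-no-fixed (suc j) fixed with fixed-⊕⁻ {X j ⊗ Cycle (3 + j)} {Y j ⊗ Fixed (3 + j)} fixed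
... | inj₁ fixed₁ = Cycle-no-fixed (suc j) (proj₂ (fixed-⊗⁻ {X j} {Cycle (3 + j)} fixed₁))
... | inj₂ fixed₂ = Y-no-fixed j (proj₁ (fixed-⊗⁻ {Y j} {Fixed (3 + j)} fixed₂))

X≇Y : ∀ j → ¬ (X j ≅ Y j)
X≇Y j X≅Y = Y-no-fixed j (≅-fixed X≅Y (X-fixed j))

-- Maps into a sum of cycles

-- The point of phase c on the cycle of length k; junk unless 2 ≤ k ≤ 2 + j.
point : (j k c : ℕ) → Fin (size (Cycles j))
point zero    k c = c mod 2
point (suc j) k c with k ≟ℕ 3 + j
... | yes _ = join (size (Cycles j)) (3 + j) (inj₂ (c mod (3 + j)))
... | no  _ = join (size (Cycles j)) (3 + j) (inj₁ (point j k c))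

point-suc : ∀ j k c → fun (Cycles j) (point j k c) ≡ point j k (suc c)
point-suc zero    k c = shift-mod 1 c
point-suc (suc j) k c with k ≟ℕ 3 + j
... | yes _ = trans (⊕ᶠ-join (fun (Cycles j)) (shift 1) (inj₂ (c mod (3 + j)))) (cong (join _ _ ∘ inj₂) (shift-mod 1 c))
... | no  _ = trans (⊕ᶠ-join (fun (Cycles j)) (shift 1) (inj₁ (point j k c))) (cong (join _ _ ∘ inj₁) (point-suc j k c))

point-cong : ∀ j k c c′ .{{_ : NonZero k}} → 2 ≤ k → k ≤ 2 + j → c % k ≡ c′ % k → point j k c ≡ point j k c′
point-cong zero k c c′ 2≤k k≤2 c≡c′ with ≤-antisym k≤2 2≤k
... | refl = mod-cong {m = c} {c′} c≡c′
point-cong (suc j) k c c′ 2≤k k≤3+j c≡c′ with k ≟ℕ 3 + j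
... | yes refl = cong (join (size (Cycles j)) (3 + j) ∘ inj₂) (mod-cong {m = c} {c′} c≡c′)
... | no  k≢3+j = cong (join (size (Cycles j)) (3 + j) ∘ inj₁) (point-cong j k c c′ 2≤k (≤-pred (≤∧≢⇒< k≤3+j k≢3+j)) c≡c′)

record Least (P : ℕ → Set) : Set where
  field
    value   : ℕ
    holds   : P value
    minimal : ∀ {n} → n < value → ¬ P n

open Least

module _ {P : ℕ → Set} (P? : Decidable P) where

  private
    search : ∀ n → Least P ⊎ (∀ {i} → i < n → ¬ P i)
    search zero = inj₂ λ ()
    search (suc n) with search n
    ... | inj₁ found = inj₁ found
    ... | inj₂ none with P? n
    ...   | yes pn = inj₁ (record { value = n ; holds = pn ; minimal = none })
    ...   | no ¬pn = inj₂ λ i<1+n → [ none , (λ { refl → ¬pn }) ]′ (m≤n⇒m<n∨m≡n (≤-pred i<1+n))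

  least : ∀ {n} → P n → Least P
  least {n} pn = [ id , (λ none → ⊥-elim (none (n<1+n n) pn)) ]′ (search (suc n))

least-≤ : ∀ {P n} (M : Least P) → P n → value M ≤ n
least-≤ M pn = ≮⇒≥ λ n<value → minimal M n<value pn

least-unique : ∀ {P Q} → (∀ {n} → P n → Q n) → (∀ {n} → Q n → P n) → (M : Least P) (N : Least Q) → value M ≡ value N
least-unique P⇒Q Q⇒P M N = ≤-antisym (least-≤ M (Q⇒P (holds N))) (least-≤ N (P⇒Q (holds M)))

module Orbits {h : ℕ} (F : Fin h → Fin h) where

  iter : ℕ → Fin h → Fin h
  iter n x = fold x F n

  iter-+ : ∀ m n x → iter (m + n) x ≡ iter m (iter n x)
  iter-+ m n x = fold-+ x F m

  iter-comm : ∀ m n x → iter m (iter n x) ≡ iter n (iter m x)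
  iter-comm m n x = begin
    iter m (iter n x)  ≡⟨ iter-+ m n x ⟨
    iter (m + n) x     ≡⟨ cong (λ t → iter t x) (+-comm m n) ⟩
    iter (n + m) x     ≡⟨ iter-+ n m x ⟩
    iter n (iter m x)  ∎
    where open ≡-Reasoning

  iter-F : ∀ n x → iter n (F x) ≡ F (iter n x)
  iter-F n = iter-comm n 1

  iter-∸ : ∀ {i n} x → i ≤ n → iter n x ≡ iter (n ∸ i) (iter i x)
  iter-∸ {i} {n} x i≤n = trans (cong (λ t → iter t x) (sym (m∸n+n≡m i≤n))) (iter-+ (n ∸ i) i x)

  iter-*-period : ∀ {k z} → iter k z ≡ z → ∀ n → iter (n * k) z ≡ z
  iter-*-period {k} {z} kz zero    = refl
  iter-*-period {k} {z} kz (suc n) = trans (iter-+ k (n * k) z) (trans (cong (iter k) (iter-*-period kz n)) kz)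

  iter-%-period : ∀ {k z} .{{_ : NonZero k}} → iter k z ≡ z → ∀ i → iter i z ≡ iter (i % k) z
  iter-%-period {k} {z} kz i = begin
    iter i z                           ≡⟨ cong (λ t → iter t z) (m≡m%n+[m/n]*n i k) ⟩
    iter (i % k + i / k * k) z         ≡⟨ iter-+ (i % k) (i / k * k) z ⟩
    iter (i % k) (iter (i / k * k) z)  ≡⟨ cong (iter (i % k)) (iter-*-period kz (i / k)) ⟩
    iter (i % k) z                     ∎
    where open ≡-Reasoning

  iter-period-invariant : ∀ {k z} → iter k z ≡ z → ∀ i → iter k (iter i z) ≡ iter i z
  iter-period-invariant {k} {z} kz i = trans (iter-comm k i z) (cong (iter i) kz)

  collision⇒periodic : ∀ {i j n} x → i ≤ j → iter i x ≡ iter j x → i ≤ n → iter (j ∸ i) (iter n x) ≡ iter n x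
  collision⇒periodic {i} {j} {n} x i≤j collision i≤n = begin
    iter (j ∸ i) (iter n x)                   ≡⟨ cong (iter (j ∸ i)) (iter-∸ x i≤n) ⟩
    iter (j ∸ i) (iter (n ∸ i) (iter i x))    ≡⟨ iter-comm (j ∸ i) (n ∸ i) (iter i x) ⟩
    iter (n ∸ i) (iter (j ∸ i) (iter i x))    ≡⟨ cong (iter (n ∸ i)) (iter-∸ x i≤j) ⟨
    iter (n ∸ i) (iter j x)                   ≡⟨ cong (iter (n ∸ i)) collision ⟨
    iter (n ∸ i) (iter i x)                   ≡⟨ iter-∸ x i≤n ⟨
    iter n x                                  ∎
    where open ≡-Reasoning

  eventually-periodic : ∀ x → ∃ λ p → iter (suc p) (iter h x) ≡ iter h x
  eventually-periodic x with pigeonhole (n<1+n h) (λ (i : Fin (suc h)) → iter (toℕ i) x)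
  ... | i , j , i<j , collision =
    positive (m<n⇒0<n∸m i<j) (collision⇒periodic x (<⇒≤ i<j) collision (toℕ≤pred[n] i))
    where
    positive : ∀ {q z} → 0 < q → iter q z ≡ z → ∃ λ p → iter (suc p) z ≡ z
    positive {suc p} _ qz = p , qz

  MinimalPeriod : Fin h → Set
  MinimalPeriod z = Least (λ p → iter (suc p) z ≡ z)

  minimalPeriod : ∀ {p z} → iter (suc p) z ≡ z → MinimalPeriod z
  minimalPeriod {p} {z} = least (λ p → iter (suc p) z ≟ᶠ z) {p}

  period : ∀ {z} → MinimalPeriod z → ℕ
  period K = suc (value K)

  period-cong : ∀ {z z′} → z ≡ z′ → (K : MinimalPeriod z) (K′ : MinimalPeriod z′) → period K ≡ period K′
  period-cong refl K K′ = cong suc (least-unique id id K K′)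

  module _ {z} (K : MinimalPeriod z) where

    no-early-return : ∀ {i j} → i < j → j < period K → iter i z ≢ iter j z
    no-early-return {i} {j} i<j j<k eq = minimal K s+i<p returns
      where
      s = proj₁ (m≤n⇒∃[o]m+o≡n (≤-pred j<k))
      j+s≡p = proj₂ (m≤n⇒∃[o]m+o≡n (≤-pred j<k))
      s+i<p : s + i < value K
      s+i<p = begin-strict
        s + i    <⟨ +-monoʳ-< s i<j ⟩
        s + j    ≡⟨ +-comm s j ⟩
        j + s    ≡⟨ j+s≡p ⟩
        value K  ∎
        where open ≤-Reasoning
      returns : iter (suc (s + i)) z ≡ z
      returns = begin
        iter (suc s + i) z         ≡⟨ iter-+ (suc s) i z ⟩
        iter (suc s) (iter i z)    ≡⟨ cong (iter (suc s)) eq ⟩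
        iter (suc s) (iter j z)    ≡⟨ iter-+ (suc s) j z ⟨
        iter (suc (s + j)) z       ≡⟨ cong (λ t → iter (suc t) z) (trans (+-comm s j) j+s≡p) ⟩
        iter (period K) z          ≡⟨ holds K ⟩
        z                          ∎
        where open ≡-Reasoning

    iter-injective-below-period : ∀ {i j} → i < period K → j < period K → iter i z ≡ iter j z → i ≡ j
    iter-injective-below-period {i} {j} i<k j<k eq with <-cmp i j
    ... | tri< i<j _ _ = ⊥-elim (no-early-return i<j j<k eq)
    ... | tri≈ _ i≡j _ = i≡j
    ... | tri> _ _ j<i = ⊥-elim (no-early-return j<i i<k (sym eq))

    iter-injective-mod-period : ∀ {i j} → iter i z ≡ iter j z → i % period K ≡ j % period K
    iter-injective-mod-period {i} {j} eq = iter-injective-below-period (m%n<n i (period K)) (m%n<n j (period K)) (begin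
      iter (i % period K) z  ≡⟨ iter-%-period (holds K) i ⟨
      iter i z               ≡⟨ eq ⟩
      iter j z               ≡⟨ iter-%-period (holds K) j ⟩
      iter (j % period K) z  ∎)
      where open ≡-Reasoning

    period-≤-size : period K ≤ h
    period-≤-size = injective⇒≤ {f = λ (i : Fin (period K)) → iter (toℕ i) z}
      (λ eq → toℕ-injective (iter-injective-below-period (toℕ<n _) (toℕ<n _) eq))

    period-≥2 : (∀ x → F x ≢ x) → 2 ≤ period K
    period-≥2 noFixed with value K | holds K
    ... | zero  | Fz≡z = ⊥-elim (noFixed z Fz≡z)
    ... | suc _ | _    = s≤s (s≤s z≤n)

  IndexOnOrbit : Fin h → ℕ → Set
  IndexOnOrbit z y = ∃ λ i → toℕ (iter i z) ≡ y

  module _ {p z} (periodic : iter (suc p) z ≡ z) where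

    indexOnOrbit? : Decidable (IndexOnOrbit z)
    indexOnOrbit? y = map′ (λ (i , eq) → toℕ i , eq) below-period (any? λ (i : Fin (suc p)) → toℕ (iter (toℕ i) z) ≟ℕ y)
      where
      below-period : IndexOnOrbit z y → ∃ λ (i : Fin (suc p)) → toℕ (iter (toℕ i) z) ≡ y
      below-period (i , eq) = i mod suc p , (begin
        toℕ (iter (toℕ (i mod suc p)) z)  ≡⟨ cong (λ t → toℕ (iter t z)) (toℕ-mod i) ⟩
        toℕ (iter (i % suc p) z)          ≡⟨ cong toℕ (iter-%-period periodic i) ⟨
        toℕ (iter i z)                    ≡⟨ eq ⟩
        y                                 ∎)
        where open ≡-Reasoning

    indexOnOrbit-F : ∀ {y} → IndexOnOrbit z y → IndexOnOrbit (F z) y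
    indexOnOrbit-F {y} (i , eq) = i + p , (begin
      toℕ (iter (i + p) (F z))     ≡⟨ cong toℕ (iter-F (i + p) z) ⟩
      toℕ (iter (suc (i + p)) z)   ≡⟨ cong (λ t → toℕ (iter t z)) (+-suc i p) ⟨
      toℕ (iter (i + suc p) z)     ≡⟨ cong toℕ (iter-+ i (suc p) z) ⟩
      toℕ (iter i (iter (suc p) z)) ≡⟨ cong (toℕ ∘ iter i) periodic ⟩
      toℕ (iter i z)               ≡⟨ eq ⟩
      y                            ∎)
      where open ≡-Reasoning

    returns-to : ∀ i → ∃ λ t → iter t (iter i z) ≡ z
    returns-to i = k ∸ i % k , (begin
      iter (k ∸ i % k) (iter i z)         ≡⟨ cong (iter (k ∸ i % k)) (iter-%-period periodic i) ⟩
      iter (k ∸ i % k) (iter (i % k) z)   ≡⟨ iter-+ (k ∸ i % k) (i % k) z ⟨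
      iter (k ∸ i % k + i % k) z          ≡⟨ cong (λ t → iter t z) (m∸n+n≡m (m%n≤n i k)) ⟩
      iter k z                            ≡⟨ periodic ⟩
      z                                   ∎)
      where
      open ≡-Reasoning
      k = suc p

  indexOnOrbit-F⁻ : ∀ {z y} → IndexOnOrbit (F z) y → IndexOnOrbit z y
  indexOnOrbit-F⁻ {z} (i , eq) = suc i , trans (cong toℕ (sym (iter-F i z))) eq

  leastPoint : ∀ {z} → Least (IndexOnOrbit z) → Fin h
  leastPoint {z} M = iter (proj₁ (holds M)) z

  leastPoint-F : ∀ {p z z′} → iter (suc p) z ≡ z → z′ ≡ F z →
           (M : Least (IndexOnOrbit z)) (M′ : Least (IndexOnOrbit z′)) → leastPoint M′ ≡ leastPoint M
  leastPoint-F {p} periodic refl M M′ = toℕ-injective (begin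
    toℕ (leastPoint M′)  ≡⟨ proj₂ (holds M′) ⟩
    value M′       ≡⟨ least-unique indexOnOrbit-F⁻ (indexOnOrbit-F {p} periodic) M′ M ⟩
    value M        ≡⟨ proj₂ (holds M) ⟨
    toℕ (leastPoint M)   ∎)
    where open ≡-Reasoning

  -- The anchor of b is the point of least index on the cycle that b has entered after h steps;
  -- its phase is a time at which the anchor reaches that point, well defined modulo the cycle length.
  landing : Fin h → Fin h
  landing b = iter h b

  landingPeriod : Fin h → ℕ
  landingPeriod b = proj₁ (eventually-periodic b)

  landing-periodic : ∀ b → iter (suc (landingPeriod b)) (landing b) ≡ landing b
  landing-periodic b = proj₂ (eventually-periodic b)

  anchorIndex : ∀ b → Least (IndexOnOrbit (landing b))
  anchorIndex b = least (indexOnOrbit? {landingPeriod b} (landing-periodic b)) (0 , refl)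

  anchor : Fin h → Fin h
  anchor b = leastPoint (anchorIndex b)

  anchor-F : ∀ b → anchor (F b) ≡ anchor b
  anchor-F b = leastPoint-F {landingPeriod b} (landing-periodic b) (iter-F h b) (anchorIndex b) (anchorIndex (F b))

  anchorPeriod : ∀ b → MinimalPeriod (anchor b)
  anchorPeriod b = minimalPeriod {landingPeriod b}
    (iter-period-invariant {suc (landingPeriod b)} {landing b} (landing-periodic b) (proj₁ (holds (anchorIndex b))))

  cycleLength : Fin h → ℕ
  cycleLength b = period (anchorPeriod b)

  cycleLength-F : ∀ b → cycleLength (F b) ≡ cycleLength b
  cycleLength-F b = period-cong (anchor-F b) (anchorPeriod (F b)) (anchorPeriod b)

  anchor-returns : ∀ b → ∃ λ t → iter t (anchor b) ≡ landing b
  anchor-returns b = returns-to {landingPeriod b} (landing-periodic b) (proj₁ (holds (anchorIndex b)))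

  phase : Fin h → ℕ
  phase b = proj₁ (anchor-returns b)

  phase-spec : ∀ b → iter (phase b) (anchor b) ≡ landing b
  phase-spec b = proj₂ (anchor-returns b)

  phase-F : ∀ b → phase (F b) % cycleLength b ≡ suc (phase b) % cycleLength b
  phase-F b = iter-injective-mod-period (anchorPeriod b) {phase (F b)} {suc (phase b)} (begin
    iter (phase (F b)) (anchor b)      ≡⟨ cong (iter (phase (F b))) (anchor-F b) ⟨
    iter (phase (F b)) (anchor (F b))  ≡⟨ phase-spec (F b) ⟩
    landing (F b)                      ≡⟨ iter-F h b ⟩
    F (landing b)                      ≡⟨ cong F (phase-spec b) ⟨
    iter (suc (phase b)) (anchor b)    ∎)
    where open ≡-Reasoning

  toCycles : (∀ x → F x ≢ x) → ∀ j → h ≤ 2 + j → Hom (mkFDDS h F) (Cycles j)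
  toCycles noFixed j h≤2+j = (λ b → point j (cycleLength b) (phase b)) , point-F
    where
    point-F : ∀ b → point j (cycleLength (F b)) (phase (F b)) ≡ fun (Cycles j) (point j (cycleLength b) (phase b))
    point-F b = begin
      point j (cycleLength (F b)) (phase (F b))  ≡⟨ cong (λ k → point j k (phase (F b))) (cycleLength-F b) ⟩
      point j (cycleLength b) (phase (F b))      ≡⟨ point-cong j (cycleLength b) (phase (F b)) (suc (phase b))
                                                      (period-≥2 (anchorPeriod b) noFixed)
                                                      (≤-trans (period-≤-size (anchorPeriod b)) h≤2+j) (phase-F b) ⟩
      point j (cycleLength b) (suc (phase b))    ≡⟨ point-suc j (cycleLength b) (phase b) ⟨
      fun (Cycles j) (point j (cycleLength b) (phase b)) ∎
      where open ≡-Reasoning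

no-dendron⇒no-fixed-point : {A : FDDS} → ¬ ContainsDendron A → ∀ x → fun A x ≢ x
no-dendron⇒no-fixed-point noDendron x fx≡x = noDendron (x , x , rfl x , fx≡x)

sumFrom-cong : (A : ℕ → FDDS) {P Q : FDDS} → ∀ k n → (∀ i → i < k + n → (A i ⊗ (P ^ i)) ≅ (A i ⊗ (Q ^ i))) →
               sumFrom A P k n ≅ sumFrom A Q k n
sumFrom-cong A k zero    terms = ≅-refl
sumFrom-cong A k (suc n) terms = ≅-⊕ (terms k (m<m+n k z<s))
  (sumFrom-cong A (suc k) n λ i i<1+k+n → terms i (subst (i <_) (sym (+-suc k n)) i<1+k+n))

maxSize : (ℕ → FDDS) → ℕ → ℕ
maxSize A zero    = size (A 0)
maxSize A (suc n) = size (A (suc n)) ⊔ maxSize A n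

size≤maxSize : ∀ A {i n} → i ≤ n → size (A i) ≤ maxSize A n
size≤maxSize A {n = zero}  z≤n = ≤-refl
size≤maxSize A {n = suc n} i≤1+n with m≤n⇒m<n∨m≡n i≤1+n
... | inj₁ i<1+n = m≤n⇒m≤o⊔n _ (size≤maxSize A (≤-pred i<1+n))
... | inj₂ refl  = m≤m⊔n _ _

theorem13 : (m : ℕ) (A : ℕ → FDDS) →
    (∀ i → 1 ≤ i → i ≤ m → ¬ ContainsDendron (A i)) →
    Σ FDDS λ X → Σ FDDS λ Y → ¬ (X ≅ Y) × (evalPoly m A X ≅ evalPoly m A Y)
theorem13 m A noDendron = X N , Y N , X≇Y N , sumFrom-cong A 0 (suc m) term
  where
  N = maxSize A m
  term : ∀ i → i < suc m → (A i ⊗ (X N ^ i)) ≅ (A i ⊗ (Y N ^ i))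
  term zero    _          = ≅-refl
  term (suc i) (s≤s 1+i≤m) = fibre⇒⊗≅ (fibre-^ (fibre-pullback toCycles (fibre-Cycles N)) (suc i))
    where
    toCycles : Hom (A (suc i)) (Cycles N)
    toCycles = Orbits.toCycles (fun (A (suc i)))
                 (no-dendron⇒no-fixed-point (noDendron (suc i) (s≤s z≤n) 1+i≤m))
                 N (≤-trans (size≤maxSize A 1+i≤m) (m≤n+m N 2))
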